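{- If $G$ is a monochromatic connected graph of order $n\ge 1$ with $\alpha(G)\le 2$, then $pc_{opt}(G)\le 3$.
   Context: All graphs are finite and simple; $\alpha(G)$ is the independence number of $G$. An edge-colored graph is properly colored if no two adjacent edges share a color; an edge-colored connected graph is properly connected if between every pair of distinct vertices there is a properly colored path. A monochromatic graph is one in which every edge has color $0$; any color $i\neq 0$ is a new color. For a monochromatic connected graph $G$, $pc_{opt}(G)$ is the minimum of $p+q$ over all ways to make $G$ properly connected by recoloring $p$ edges of $G$ using $q$ new colors. -}

module Defs where

open import Data.Nat using (ℕ; _≤_; _+_)
open import Data.Fin using (Fin)
open import Data.Bool using (Bool; true; false)
open import Data.List using (List; []; _∷_; _∷ʳ_; length)
open import Data.List.Relation.Unary.Unique.Propositional using (Unique)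
open import Data.List.Membership.Propositional using (_∈_)
open import Data.Product using (Σ; _×_; _,_; ∃; ∃-syntax)
open import Data.Sum using (_⊎_)
open import Data.Unit using (⊤)
open import Relation.Nullary using (¬_)
open import Relation.Binary.PropositionalEquality using (_≡_; _≢_)

record Graph (n : ℕ) : Set where
  field
    adj    : Fin n → Fin n → Bool
    sym    : ∀ u v → adj u v ≡ adj v u
    irrefl : ∀ u → adj u u ≡ false

module _ {n : ℕ} (G : Graph n) where
  open Graph G

  Edge : Fin n → Fin n → Set
  Edge u v = adj u v ≡ true

  IsWalk : List (Fin n) → Set
  IsWalk []            = ⊤
  IsWalk (x ∷ [])      = ⊤
  IsWalk (x ∷ y ∷ r)   = Edge x y × IsWalk (y ∷ r)

  IsPath : Fin n → Fin n → List (Fin n) → Set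
  IsPath u v xs = IsWalk xs × Unique xs × Σ (List (Fin n)) (λ mid → xs ≡ (u ∷ mid) ∷ʳ v)

  Connected : Set
  Connected = ∀ u v → u ≢ v → ∃[ xs ] IsPath u v xs

  Independent : List (Fin n) → Set
  Independent xs = Unique xs × (∀ {u v} → u ∈ xs → v ∈ xs → ¬ Edge u v)

  αAtMost : ℕ → Set
  αAtMost k = ∀ xs → Independent xs → length xs ≤ k

  -- An edge colouring: a symmetric assignment of colours (ℕ) to vertex
  -- pairs; only the values on edges are relevant.  Colour 0 is the
  -- original colour; every colour ≠ 0 is new.
  record Colouring : Set where
    field
      col    : Fin n → Fin n → ℕ
      colSym : ∀ u v → col u v ≡ col v u

  module _ (c : Colouring) where
    open Colouring c

    ProperlyColoured : List (Fin n) → Set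
    ProperlyColoured (x ∷ y ∷ z ∷ r) = col x y ≢ col y z × ProperlyColoured (y ∷ z ∷ r)
    ProperlyColoured _               = ⊤

    ProperlyConnected : Set
    ProperlyConnected =
      ∀ u v → u ≢ v → ∃[ xs ] (IsPath u v xs × ProperlyColoured xs)

    -- the colouring is obtained from the monochromatic (all-0) colouring of G
    -- by recolouring (at most) the edges in es using (at most) the new
    -- colours in cs: every edge with colour ≠ 0 occurs in es (as (u,v) or
    -- (v,u)) and its colour occurs in cs.
    RecolouredWith : List (Fin n × Fin n) → List ℕ → Set
    RecolouredWith es cs =
      ∀ u v → Edge u v → col u v ≢ 0 →
        (((u , v) ∈ es) ⊎ ((v , u) ∈ es)) × col u v ∈ cs

  -- pc_opt(G) ≤ k : G can be made properly connected by recolouring p edges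
  -- with q new colours, where p + q ≤ k.
  pcOptAtMost : ℕ → Set
  pcOptAtMost k =
    ∃[ c ] ∃[ es ] ∃[ cs ]
      (RecolouredWith c es cs × ProperlyConnected c × length es + length cs ≤ k)

module Submission where

-- Every colouring used recolours the edges of a matching R with |R| ≤ 2 by
-- the single new colour 1, at cost |R| + 1 ≤ 3.  If G is complete nothing is
-- recoloured.  Otherwise fix non-adjacent u, v.  Because α(G) ≤ 2 every other
-- vertex is adjacent to u or to v, so the vertices split into u, v, the
-- private neighbourhoods A = N(u) ∖ N(v), B = N(v) ∖ N(u), and the common
-- neighbourhood C; moreover A and B are cliques.
--   * If some c ∈ C exists, recolour uc, and also vb₀ for one b₀ ∈ B when
--     B ≠ ∅.  Pairs inside N(u) or inside N(v) are joined by the star lemma;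
--     the remaining pairs by explicit alternating paths through u–c–v–b₀.
--   * If C = ∅, connectivity yields an edge ab with a ∈ A, b ∈ B; recolour
--     it.  All pairs are joined by alternating paths through a–b, and the
--     situation is symmetric in (u, a) ↔ (v, b).

open import Defs
open import Data.Nat using (ℕ; _≤_; s≤s; z≤n)
open import Data.Nat.Properties using (+-monoˡ-≤)
open import Data.Fin using (Fin; _≟_)
open import Data.Fin.Properties using (any?)
open import Data.Bool using (true) renaming (_≟_ to _≟ᵇ_)
open import Data.List using (List; []; _∷_; _∷ʳ_; _ʳ++_; reverse; length)
open import Data.List.Properties using (reverse-++; unfold-reverse)
import Data.List.Relation.Unary.All as All
open import Data.List.Relation.Unary.All using (All; []; _∷_)
open import Data.List.Relation.Unary.AllPairs using (AllPairs; []; _∷_)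
import Data.List.Relation.Unary.Any as Any
open import Data.List.Relation.Unary.Any using (Any; here; there)
open import Data.List.Relation.Unary.Unique.Propositional using (Unique)
open import Data.List.Membership.Propositional using (_∈_; find; lose)
import Data.List.Relation.Binary.Permutation.Setoid as Permutation
import Data.List.Relation.Binary.Permutation.Setoid.Properties as PermutationProperties
open import Data.Product using (_×_; _,_; ∃-syntax)
open import Data.Sum using (_⊎_; inj₁; inj₂)
import Data.Sum as Sum
open import Data.Unit using (tt)
open import Data.Empty using (⊥-elim)
open import Function using (_∘_)
open import Relation.Nullary using (¬_; Dec; yes; no)
open import Relation.Nullary.Decidable using (_×-dec_; _⊎-dec_; ¬?)
open import Relation.Binary.PropositionalEquality
  using (_≡_; _≢_; refl; sym; trans; cong; setoid; ≢-sym)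

unique-reverse : {A : Set} (xs : List A) → Unique xs → Unique (reverse xs)
unique-reverse {A} xs = Unique-resp-↭ (↭-sym (↭-reverse xs))
  where
  open Permutation (setoid A) using (↭-sym)
  open PermutationProperties (setoid A) using (Unique-resp-↭; ↭-reverse)

module _ {n : ℕ} (G : Graph n) where
  open Graph G renaming (sym to adj-sym)

  E : Fin n → Fin n → Set
  E = Edge G

  edge? : ∀ x y → Dec (E x y)
  edge? x y = adj x y ≟ᵇ true

  edge-sym : ∀ {x y} → E x y → E y x
  edge-sym {x} {y} e = trans (adj-sym y x) e

  edge-≢ : ∀ {x y} → E x y → x ≢ y
  edge-≢ {x} e refl with trans (sym e) (irrefl x)
  ... | ()

  separated : ∀ {x y} (P : Fin n → Set) → P x → ¬ P y → x ≢ y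
  separated P px ¬py refl = ¬py px

  module Proper (κ : Colouring G) where
    open Colouring κ

    ProperPath : Fin n → Fin n → Set
    ProperPath s t = ∃[ xs ] (IsPath G s t xs × ProperlyColoured G κ xs)

    -- Reversal is done with an accumulator: the accumulated prefix is
    -- already a reversed walk (resp. properly coloured) and the invariant
    -- is extended one vertex at a time.
    walk-ʳ++ : ∀ x xs acc → IsWalk G (x ∷ xs) → IsWalk G (x ∷ acc) →
               IsWalk G ((x ∷ xs) ʳ++ acc)
    walk-ʳ++ x []       acc _        w   = w
    walk-ʳ++ x (y ∷ ys) acc (xy , w) wac = walk-ʳ++ y ys (x ∷ acc) w (edge-sym xy , wac)

    proper-ʳ++ : ∀ x y xs acc → ProperlyColoured G κ (x ∷ y ∷ xs) →
                 ProperlyColoured G κ (y ∷ x ∷ acc) →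
                 ProperlyColoured G κ ((x ∷ y ∷ xs) ʳ++ acc)
    proper-ʳ++ x y []       acc _       pac = pac
    proper-ʳ++ x y (z ∷ zs) acc (d , p) pac = proper-ʳ++ y z zs (x ∷ acc) p (d′ , pac)
      where
      d′ : col z y ≢ col y x
      d′ eq = d (trans (colSym x y) (trans (sym eq) (colSym z y)))

    reverse-ends : ∀ (s : Fin n) mid t → reverse ((s ∷ mid) ∷ʳ t) ≡ (t ∷ reverse mid) ∷ʳ s
    reverse-ends s mid t =
      trans (reverse-++ (s ∷ mid) (t ∷ [])) (cong (t ∷_) (unfold-reverse s mid))

    proper-path-sym : ∀ {s t} → ProperPath s t → ProperPath t s
    proper-path-sym {s} {t} (_ , (w , u , mid , refl) , p) =
      reverse ((s ∷ mid) ∷ʳ t) ,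
      (walk-ʳ++ s (mid ∷ʳ t) [] w tt , unique-reverse ((s ∷ mid) ∷ʳ t) u ,
       reverse mid , reverse-ends s mid t) ,
      reversed ((s ∷ mid) ∷ʳ t) p
      where
      reversed : ∀ xs → ProperlyColoured G κ xs → ProperlyColoured G κ (reverse xs)
      reversed []           _ = tt
      reversed (_ ∷ [])     _ = tt
      reversed (x ∷ y ∷ xs) q = proper-ʳ++ x y xs [] q tt

    path₂ : ∀ {a b} → E a b → ProperPath a b
    path₂ {a} {b} ab = a ∷ b ∷ [] , ((ab , tt) , (edge-≢ ab ∷ []) ∷ [] ∷ [] , [] , refl) , tt

    path₃ : ∀ {a b c} → E a b → E b c → a ≢ c → col a b ≢ col b c → ProperPath a c
    path₃ {a} {b} {c} ab bc ac k₁ =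
      a ∷ b ∷ c ∷ [] ,
      ((ab , bc , tt) , (edge-≢ ab ∷ ac ∷ []) ∷ (edge-≢ bc ∷ []) ∷ [] ∷ [] , b ∷ [] , refl) ,
      k₁ , tt

    path₄ : ∀ {a b c d} → E a b → E b c → E c d → a ≢ c → a ≢ d → b ≢ d →
            col a b ≢ col b c → col b c ≢ col c d → ProperPath a d
    path₄ {a} {b} {c} {d} ab bc cd ac ad bd k₁ k₂ =
      a ∷ b ∷ c ∷ d ∷ [] ,
      ((ab , bc , cd , tt) ,
       (edge-≢ ab ∷ ac ∷ ad ∷ []) ∷ (edge-≢ bc ∷ bd ∷ []) ∷ (edge-≢ cd ∷ []) ∷ [] ∷ [] ,
       b ∷ c ∷ [] , refl) ,
      k₁ , k₂ , tt

    path₅ : ∀ {a b c d e} → E a b → E b c → E c d → E d e →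
            a ≢ c → a ≢ d → a ≢ e → b ≢ d → b ≢ e → c ≢ e →
            col a b ≢ col b c → col b c ≢ col c d → col c d ≢ col d e → ProperPath a e
    path₅ {a} {b} {c} {d} {e} ab bc cd de ac ad ae bd be ce k₁ k₂ k₃ =
      a ∷ b ∷ c ∷ d ∷ e ∷ [] ,
      ((ab , bc , cd , de , tt) ,
       (edge-≢ ab ∷ ac ∷ ad ∷ ae ∷ []) ∷ (edge-≢ bc ∷ bd ∷ be ∷ []) ∷
       (edge-≢ cd ∷ ce ∷ []) ∷ (edge-≢ de ∷ []) ∷ [] ∷ [] ,
       b ∷ c ∷ d ∷ [] , refl) ,
      k₁ , k₂ , k₃ , tt

    path₆ : ∀ {a b c d e f} → E a b → E b c → E c d → E d e → E e f →
            a ≢ c → a ≢ d → a ≢ e → a ≢ f → b ≢ d → b ≢ e → b ≢ f → c ≢ e → c ≢ f → d ≢ f →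
            col a b ≢ col b c → col b c ≢ col c d → col c d ≢ col d e → col d e ≢ col e f →
            ProperPath a f
    path₆ {a} {b} {c} {d} {e} {f} ab bc cd de ef ac ad ae af bd be bf ce cf df k₁ k₂ k₃ k₄ =
      a ∷ b ∷ c ∷ d ∷ e ∷ f ∷ [] ,
      ((ab , bc , cd , de , ef , tt) ,
       (edge-≢ ab ∷ ac ∷ ad ∷ ae ∷ af ∷ []) ∷ (edge-≢ bc ∷ bd ∷ be ∷ bf ∷ []) ∷
       (edge-≢ cd ∷ ce ∷ cf ∷ []) ∷ (edge-≢ de ∷ df ∷ []) ∷ (edge-≢ ef ∷ []) ∷ [] ∷ [] ,
       b ∷ c ∷ d ∷ e ∷ [] , refl) ,
      k₁ , k₂ , k₃ , k₄ , tt

    red≢plain : ∀ {a b c d} → col a b ≡ 1 → col c d ≡ 0 → col a b ≢ col c d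
    red≢plain r p eq with trans (sym r) (trans eq p)
    ... | ()

    plain≢red : ∀ {a b c d} → col a b ≡ 0 → col c d ≡ 1 → col a b ≢ col c d
    plain≢red p r eq = red≢plain r p (sym eq)

    flip-col : ∀ {x y k} → col x y ≡ k → col y x ≡ k
    flip-col {x} {y} eq = trans (colSym y x) eq

    record Solo (x y : Fin n) : Set where
      field
        red    : col x y ≡ 1
        only-x : ∀ w → w ≢ y → col x w ≡ 0
        only-y : ∀ w → w ≢ x → col y w ≡ 0

    solo-sym : ∀ {x y} → Solo x y → Solo y x
    solo-sym σ = record { red = flip-col red ; only-x = only-y ; only-y = only-x }
      where open Solo σ

  Joins : Fin n → Fin n → Fin n × Fin n → Set
  Joins x y (p , q) = (x ≡ p × y ≡ q) ⊎ (x ≡ q × y ≡ p)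

  joins? : ∀ x y e → Dec (Joins x y e)
  joins? x y (p , q) = (x ≟ p ×-dec y ≟ q) ⊎-dec (x ≟ q ×-dec y ≟ p)

  joins-sym : ∀ {x y e} → Joins x y e → Joins y x e
  joins-sym (inj₁ (xp , yq)) = inj₂ (yq , xp)
  joins-sym (inj₂ (xq , yp)) = inj₁ (yp , xq)

  Marked : List (Fin n × Fin n) → Fin n → Fin n → Set
  Marked R x y = Any (Joins x y) R

  marked⇒listed : ∀ {R x y} → Marked R x y → (x , y) ∈ R ⊎ (y , x) ∈ R
  marked⇒listed (here (inj₁ (refl , refl))) = inj₁ (here refl)
  marked⇒listed (here (inj₂ (refl , refl))) = inj₂ (here refl)
  marked⇒listed (there m) = Sum.map there there (marked⇒listed m)

  indicator : {A : Set} → Dec A → ℕ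
  indicator (yes _) = 1
  indicator (no _)  = 0

  matchingColouring : List (Fin n × Fin n) → Colouring G
  matchingColouring R = record { col = λ x y → indicator (Any.any? (joins? x y) R) ; colSym = sym′ }
    where
    sym′ : ∀ x y → indicator (Any.any? (joins? x y) R) ≡ indicator (Any.any? (joins? y x) R)
    sym′ x y with Any.any? (joins? x y) R | Any.any? (joins? y x) R
    ... | yes _ | yes _ = refl
    ... | no _  | no _  = refl
    ... | yes m | no ¬m = ⊥-elim (¬m (Any.map joins-sym m))
    ... | no ¬m | yes m = ⊥-elim (¬m (Any.map joins-sym m))

  module _ (R : List (Fin n × Fin n)) where
    open Colouring (matchingColouring R)

    marked⇒red : ∀ {x y} → Marked R x y → col x y ≡ 1
    marked⇒red {x} {y} m with Any.any? (joins? x y) R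
    ... | yes _ = refl
    ... | no ¬m = ⊥-elim (¬m m)

    unmarked⇒plain : ∀ {x y} → ¬ Marked R x y → col x y ≡ 0
    unmarked⇒plain {x} {y} ¬m with Any.any? (joins? x y) R
    ... | yes m = ⊥-elim (¬m m)
    ... | no _  = refl

    matching-recoloured : RecolouredWith G (matchingColouring R) R (1 ∷ [])
    matching-recoloured x y _ nonzero with Any.any? (joins? x y) R
    ... | yes m = marked⇒listed m , here refl
    ... | no _  = ⊥-elim (nonzero refl)

    matching-pcOpt : length R ≤ 2 → ProperlyConnected G (matchingColouring R) → pcOptAtMost G 3
    matching-pcOpt small pc =
      matchingColouring R , R , 1 ∷ [] , matching-recoloured , pc , +-monoˡ-≤ 1 small

  Touches : Fin n → Fin n × Fin n → Set
  Touches x (p , q) = x ≡ p ⊎ x ≡ q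

  Disjoint : Fin n × Fin n → Fin n × Fin n → Set
  Disjoint e e′ = ∀ {x} → Touches x e → ¬ Touches x e′

  disjoint : ∀ {p q p′ q′} → p ≢ p′ → p ≢ q′ → q ≢ p′ → q ≢ q′ → Disjoint (p , q) (p′ , q′)
  disjoint pp _  _  _  (inj₁ refl) (inj₁ refl) = pp refl
  disjoint _  pq _  _  (inj₁ refl) (inj₂ refl) = pq refl
  disjoint _  _  qp _  (inj₂ refl) (inj₁ refl) = qp refl
  disjoint _  _  _  qq (inj₂ refl) (inj₂ refl) = qq refl

  Loopless : Fin n × Fin n → Set
  Loopless (p , q) = p ≢ q

  IsMatching : List (Fin n × Fin n) → Set
  IsMatching R = All Loopless R × AllPairs Disjoint R

  joins⇒touches : ∀ {x y e} → Joins x y e → Touches x e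
  joins⇒touches (inj₁ (xp , _)) = inj₁ xp
  joins⇒touches (inj₂ (xq , _)) = inj₂ xq

  touched-once : ∀ {R e e′ x} → AllPairs Disjoint R → e ∈ R → e′ ∈ R →
                 Touches x e → Touches x e′ → e ≡ e′
  touched-once (_ ∷ _)  (here refl) (here refl)  _  _   = refl
  touched-once (d ∷ _)  (here refl) (there e′∈R) tx tx′ = ⊥-elim (All.lookup d e′∈R tx tx′)
  touched-once (d ∷ _)  (there e∈R) (here refl)  tx tx′ = ⊥-elim (All.lookup d e∈R tx′ tx)
  touched-once (_ ∷ ds) (there e∈R) (there e′∈R) tx tx′ = touched-once ds e∈R e′∈R tx tx′

  matching-solo : ∀ {R p q} → IsMatching R → (p , q) ∈ R →
                  Proper.Solo (matchingColouring R) p q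
  matching-solo {R} {p} {q} (loopless , disj) pq∈R = record
    { red    = marked⇒red R (lose pq∈R (inj₁ (refl , refl)))
    ; only-x = λ w w≢q → unmarked⇒plain R λ m → case-p w≢q (joined-at (inj₁ refl) m)
    ; only-y = λ w w≢p → unmarked⇒plain R λ m → case-q w≢p (joined-at (inj₂ refl) m)
    }
    where
    p≢q : p ≢ q
    p≢q = All.lookup loopless pq∈R
    joined-at : ∀ {x w} → Touches x (p , q) → Marked R x w → Joins x w (p , q)
    joined-at tx m with find m
    ... | e , e∈R , j with touched-once disj e∈R pq∈R (joins⇒touches j) tx
    ...   | refl = j
    case-p : ∀ {w} → w ≢ q → ¬ Joins p w (p , q)
    case-p w≢q (inj₁ (_ , w≡q))   = w≢q w≡q
    case-p _   (inj₂ (p≡q , _))   = p≢q p≡q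
    case-q : ∀ {w} → w ≢ p → ¬ Joins q w (p , q)
    case-q _   (inj₁ (q≡p , _))   = p≢q (sym q≡p)
    case-q w≢p (inj₂ (_ , w≡p))   = w≢p w≡p

  NonAdjacentPair : Set
  NonAdjacentPair = ∃[ u ] ∃[ v ] (u ≢ v × ¬ E u v)

  nonAdjacentPair? : Dec NonAdjacentPair
  nonAdjacentPair? = any? λ u → any? λ v → ¬? (u ≟ v) ×-dec ¬? (edge? u v)

  complete-pcOpt : ¬ NonAdjacentPair → pcOptAtMost G 3
  complete-pcOpt complete = matching-pcOpt [] z≤n adjacent
    where
    open Proper (matchingColouring [])
    adjacent : ProperlyConnected G (matchingColouring [])
    adjacent s t s≢t with edge? s t
    ... | yes st = path₂ st
    ... | no ¬st = ⊥-elim (complete (s , t , s≢t , ¬st))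

  leaving-edge : ∀ (P : Fin n → Set) → (∀ w → Dec (P w)) → ∀ {v} x mid →
                 P x → ¬ P v → IsWalk G ((x ∷ mid) ∷ʳ v) →
                 ∃[ y ] ∃[ z ] (E y z × P y × ¬ P z)
  leaving-edge P P? {v} x []        px ¬pv (xv , _) = x , v , xv , px , ¬pv
  leaving-edge P P? x (m ∷ mid) px ¬pv (xm , w) with P? m
  ... | yes pm = leaving-edge P P? m mid pm ¬pv w
  ... | no ¬pm = x , m , xm , px , ¬pm

  module _ (α2 : αAtMost G 2) where

    -- For non-adjacent x, y every third vertex is adjacent to x or to y,
    -- since otherwise {x, y, z} would be independent.
    dominated : ∀ {x y z} → ¬ E x y → x ≢ y → z ≢ x → z ≢ y → E x z ⊎ E y z
    dominated {x} {y} {z} ¬xy x≢y z≢x z≢y with edge? x z | edge? y z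
    ... | yes xz | _      = inj₁ xz
    ... | no _   | yes yz = inj₂ yz
    ... | no ¬xz | no ¬yz = ⊥-elim (three≰two (α2 (x ∷ y ∷ z ∷ []) (distinct , independent)))
      where
      distinct : Unique (x ∷ y ∷ z ∷ [])
      distinct = (x≢y ∷ ≢-sym z≢x ∷ []) ∷ (≢-sym z≢y ∷ []) ∷ [] ∷ []
      ¬loop : ∀ {w} → ¬ E w w
      ¬loop e = edge-≢ e refl
      independent : ∀ {a b} → a ∈ (x ∷ y ∷ z ∷ []) → b ∈ (x ∷ y ∷ z ∷ []) → ¬ E a b
      independent (here refl)                 (here refl)                 = ¬loop
      independent (here refl)                 (there (here refl))         = ¬xy
      independent (here refl)                 (there (there (here refl))) = ¬xz
      independent (there (here refl))         (here refl)                 = ¬xy ∘ edge-sym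
      independent (there (here refl))         (there (here refl))         = ¬loop
      independent (there (here refl))         (there (there (here refl))) = ¬yz
      independent (there (there (here refl))) (here refl)                 = ¬xz ∘ edge-sym
      independent (there (there (here refl))) (there (here refl))         = ¬yz ∘ edge-sym
      independent (there (there (here refl))) (there (there (here refl))) = ¬loop
      three≰two : ¬ (3 ≤ 2)
      three≰two (s≤s (s≤s ()))

    -- The private neighbourhood of x with respect to a non-neighbour y is a
    -- clique: two non-adjacent private neighbours would, with y, be independent.
    private-clique : ∀ {x y a a′} → ¬ E x y → E x a → ¬ E y a → E x a′ → ¬ E y a′ → a ≢ a′ →
                     E a a′
    private-clique {x} ¬xy xa ¬ya xa′ ¬ya′ a≢a′ with edge? _ _
    ... | yes aa′ = aa′
    ... | no ¬aa′ with dominated ¬aa′ a≢a′ (≢-sym (separated (E x) xa ¬xy))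
                                          (≢-sym (separated (E x) xa′ ¬xy))
    ...   | inj₁ ay  = ⊥-elim (¬ya (edge-sym ay))
    ...   | inj₂ a′y = ⊥-elim (¬ya′ (edge-sym a′y))

    data Place (u v w : Fin n) : Set where
      at-u   : w ≡ u → Place u v w
      at-v   : w ≡ v → Place u v w
      only-u : E u w → ¬ E v w → Place u v w
      only-v : E v w → ¬ E u w → Place u v w
      both   : E u w → E v w → Place u v w

    -- Every vertex has a place; "neither neighbour" is excluded by α(G) ≤ 2.
    place : ∀ {u v} → u ≢ v → ¬ E u v → ∀ w → Place u v w
    place {u} {v} u≢v ¬uv w with w ≟ u | w ≟ v | edge? u w | edge? v w
    ... | yes w≡u | _       | _      | _      = at-u w≡u
    ... | no _    | yes w≡v | _      | _      = at-v w≡v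
    ... | no _    | no _    | yes uw | yes vw = both uw vw
    ... | no _    | no _    | yes uw | no ¬vw = only-u uw ¬vw
    ... | no _    | no _    | no ¬uw | yes vw = only-v vw ¬uw
    ... | no w≢u  | no w≢v  | no ¬uw | no ¬vw with dominated ¬uv u≢v w≢u w≢v
    ...   | inj₁ uw = ⊥-elim (¬uw uw)
    ...   | inj₂ vw = ⊥-elim (¬vw vw)

    module _ (κ : Colouring G) where
      open Proper κ
      open Colouring κ

      -- Non-adjacent neighbours s, t of x are properly connected when xc is
      -- solo: through x if one of them is c, and otherwise c is adjacent to s
      -- or t (α(G) ≤ 2), giving the alternating detour s–c–x–t or s–x–c–t.
      module _ {x c : Fin n} (σ : Solo x c) (xc : E x c) where
        open Solo σ

        star : ∀ {s t} → E x s → E x t → s ≢ t → ¬ E s t → ProperPath s t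
        star {s} {t} xs xt s≢t ¬st with s ≟ c | t ≟ c
        ... | yes refl | yes refl = ⊥-elim (s≢t refl)
        ... | yes refl | no t≢c   =
          path₃ (edge-sym xs) xt s≢t (red≢plain (flip-col red) (only-x t t≢c))
        ... | no s≢c   | yes refl =
          path₃ (edge-sym xs) xt s≢t (plain≢red (flip-col (only-x s s≢c)) red)
        ... | no s≢c   | no t≢c with dominated ¬st s≢t (≢-sym s≢c) (≢-sym t≢c)
        ...   | inj₁ sc = path₄ sc (edge-sym xc) xt (≢-sym (edge-≢ xs)) s≢t (≢-sym t≢c)
                            (plain≢red (flip-col (only-y s (≢-sym (edge-≢ xs)))) (flip-col red))
                            (red≢plain (flip-col red) (only-x t t≢c))
        ...   | inj₂ tc = path₄ (edge-sym xs) xc (edge-sym tc) s≢c s≢t (edge-≢ xt)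
                            (plain≢red (flip-col (only-x s s≢c)) red)
                            (red≢plain red (only-y t (≢-sym (edge-≢ xt))))

      -- Pairs inside N(u) or N(v) are handled by the star
      -- lemma, the others by alternating paths along u–c–v–b.
      module CommonNeighbour {u v c : Fin n} (u≢v : u ≢ v) (¬uv : ¬ E u v) (uc : E u c) (vc : E v c)
               (σu : Solo u c)
               (σv : ∀ {t} → E v t → ¬ E u t → ∃[ b ] (E v b × ¬ E u b × Solo v b)) where
        open Solo σu

        ¬vu : ¬ E v u
        ¬vu = ¬uv ∘ edge-sym

        cv-plain : col c v ≡ 0
        cv-plain = only-y v (≢-sym u≢v)

        u⇝v : ProperPath u v
        u⇝v = path₃ uc (edge-sym vc) u≢v (red≢plain red cv-plain)

        v⇝private-u : ∀ {t} → E u t → ¬ E v t → ProperPath v t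
        v⇝private-u {t} ut ¬vt =
          path₄ vc (edge-sym uc) ut (≢-sym u≢v) (≢-sym (separated (E u) ut ¬uv)) c≢t
            (plain≢red (flip-col cv-plain) (flip-col red)) (red≢plain (flip-col red) (only-x t (≢-sym c≢t)))
          where
          c≢t : c ≢ t
          c≢t = separated (E v) vc ¬vt

        -- u–c–v–b, continued by b–t unless t = b
        u⇝private-v : ∀ {t} → E v t → ¬ E u t → ProperPath u t
        u⇝private-v {t} vt ¬ut = via (σv vt ¬ut)
          where
          u≢t : u ≢ t
          u≢t = ≢-sym (separated (E v) vt ¬vu)
          c≢t : c ≢ t
          c≢t = separated (E u) uc ¬ut
          via : ∃[ b ] (E v b × ¬ E u b × Solo v b) → ProperPath u t
          via (b , vb , ¬ub , σb) with t ≟ b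
          ... | yes refl = path₄ uc (edge-sym vc) vb u≢v u≢t c≢t
                             (red≢plain red cv-plain) (plain≢red cv-plain (Solo.red σb))
          ... | no t≢b = path₅ uc (edge-sym vc) vb (private-clique ¬vu vb ¬ub vt ¬ut (≢-sym t≢b))
                           u≢v (≢-sym (separated (E v) vb ¬vu)) u≢t (separated (E u) uc ¬ub) c≢t (edge-≢ vt)
                           (red≢plain red cv-plain) (plain≢red cv-plain (Solo.red σb))
                           (red≢plain (Solo.red σb) (Solo.only-y σb t (≢-sym (edge-≢ vt))))

        -- s–u–c–v–b, continued by b–t unless t = b
        private-u⇝private-v : ∀ {s t} → E u s → ¬ E v s → E v t → ¬ E u t → ProperPath s t
        private-u⇝private-v {s} {t} us ¬vs vt ¬ut = via (σv vt ¬ut)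
          where
          s≢c : s ≢ c
          s≢c = ≢-sym (separated (E v) vc ¬vs)
          s≢v : s ≢ v
          s≢v = separated (E u) us ¬uv
          su-plain : col s u ≡ 0
          su-plain = flip-col (only-x s s≢c)
          via : ∃[ b ] (E v b × ¬ E u b × Solo v b) → ProperPath s t
          via (b , vb , ¬ub , σb) with t ≟ b
          ... | yes refl = path₅ (edge-sym us) uc (edge-sym vc) vb
                             s≢c s≢v (separated (E u) us ¬ut) u≢v (≢-sym (separated (E v) vb ¬vu))
                             (separated (E u) uc ¬ub)
                             (plain≢red su-plain red) (red≢plain red cv-plain)
                             (plain≢red cv-plain (Solo.red σb))
          ... | no t≢b = path₆ (edge-sym us) uc (edge-sym vc) vb
                           (private-clique ¬vu vb ¬ub vt ¬ut (≢-sym t≢b))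
                           s≢c s≢v (separated (E u) us ¬ub) (separated (E u) us ¬ut)
                           u≢v (≢-sym (separated (E v) vb ¬vu)) (≢-sym (separated (E v) vt ¬vu))
                           (separated (E u) uc ¬ub) (separated (E u) uc ¬ut) (edge-≢ vt)
                           (plain≢red su-plain red) (red≢plain red cv-plain)
                           (plain≢red cv-plain (Solo.red σb))
                           (red≢plain (Solo.red σb) (Solo.only-y σb t (≢-sym (edge-≢ vt))))

        -- pairs inside N(v), using a private neighbour w of v to find a solo edge at v
        within-N[v] : ∀ {w s t} → E v w → ¬ E u w → E v s → E v t → s ≢ t → ¬ E s t → ProperPath s t
        within-N[v] vw ¬uw with σv vw ¬uw
        ... | b , vb , _ , σb = star σb vb

        between : ∀ {s t} → s ≢ t → ¬ E s t → Place u v s → Place u v t → ProperPath s t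
        between s≢t _   (at-u refl)     (at-u refl)     = ⊥-elim (s≢t refl)
        between _   _   (at-u refl)     (at-v refl)     = u⇝v
        between _   ¬st (at-u refl)     (only-u ut _)   = ⊥-elim (¬st ut)
        between _   _   (at-u refl)     (only-v vt ¬ut) = u⇝private-v vt ¬ut
        between _   ¬st (at-u refl)     (both ut _)     = ⊥-elim (¬st ut)
        between _   _   (at-v refl)     (at-u refl)     = proper-path-sym u⇝v
        between s≢t _   (at-v refl)     (at-v refl)     = ⊥-elim (s≢t refl)
        between _   _   (at-v refl)     (only-u ut ¬vt) = v⇝private-u ut ¬vt
        between _   ¬st (at-v refl)     (only-v vt _)   = ⊥-elim (¬st vt)
        between _   ¬st (at-v refl)     (both _ vt)     = ⊥-elim (¬st vt)
        between _   ¬st (only-u us _)   (at-u refl)     = ⊥-elim (¬st (edge-sym us))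
        between _   _   (only-u us ¬vs) (at-v refl)     = proper-path-sym (v⇝private-u us ¬vs)
        between s≢t ¬st (only-u us _)   (only-u ut _)   = star σu uc us ut s≢t ¬st
        between _   _   (only-u us ¬vs) (only-v vt ¬ut) = private-u⇝private-v us ¬vs vt ¬ut
        between s≢t ¬st (only-u us _)   (both ut _)     = star σu uc us ut s≢t ¬st
        between _   _   (only-v vs ¬us) (at-u refl)     = proper-path-sym (u⇝private-v vs ¬us)
        between _   ¬st (only-v vs _)   (at-v refl)     = ⊥-elim (¬st (edge-sym vs))
        between _   _   (only-v vs ¬us) (only-u ut ¬vt) = proper-path-sym (private-u⇝private-v ut ¬vt vs ¬us)
        between s≢t ¬st (only-v vs ¬us) (only-v vt _)   = within-N[v] vs ¬us vs vt s≢t ¬st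
        between s≢t ¬st (only-v vs ¬us) (both _ vt)     = within-N[v] vs ¬us vs vt s≢t ¬st
        between _   ¬st (both us _)     (at-u refl)     = ⊥-elim (¬st (edge-sym us))
        between _   ¬st (both _ vs)     (at-v refl)     = ⊥-elim (¬st (edge-sym vs))
        between s≢t ¬st (both us _)     (only-u ut _)   = star σu uc us ut s≢t ¬st
        between s≢t ¬st (both _ vs)     (only-v vt ¬ut) = within-N[v] vt ¬ut vs vt s≢t ¬st
        between s≢t ¬st (both us _)     (both ut _)     = star σu uc us ut s≢t ¬st

        connected : ProperlyConnected G κ
        connected s t s≢t with edge? s t
        ... | yes st = path₂ st
        ... | no ¬st = between s≢t ¬st (place u≢v ¬uv s) (place u≢v ¬uv t)

      -- The
      -- paths below go from the u-side to the v-side through ab; the reverse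
      -- directions follow by the symmetry (u, a) ↔ (v, b) and path reversal.
      module NoCommonNeighbour {u v a b : Fin n} (u≢v : u ≢ v) (¬uv : ¬ E u v)
               (no-common : ∀ {w} → E u w → ¬ E v w)
               (ua : E u a) (vb : E v b) (ab : E a b) (σ : Solo a b) where
        open Solo σ

        ¬vu : ¬ E v u
        ¬vu = ¬uv ∘ edge-sym

        ¬u-private-v : ∀ {t} → E v t → ¬ E u t
        ¬u-private-v vt ut = no-common ut vt

        u≢b : u ≢ b
        u≢b = ≢-sym (separated (E v) vb ¬vu)

        ua-plain : col u a ≡ 0
        ua-plain = flip-col (only-x u u≢b)

        private-u≢b : ∀ {s} → E u s → s ≢ b
        private-u≢b us = separated (E u) us (¬u-private-v vb)

        a≢private-v : ∀ {t} → E v t → a ≢ t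
        a≢private-v vt = separated (E u) ua (¬u-private-v vt)

        s–a : ∀ {s} → E u s → s ≢ a → E s a
        s–a us s≢a = private-clique ¬uv us (no-common us) ua (no-common ua) s≢a

        sa-plain : ∀ {s} → E u s → col s a ≡ 0
        sa-plain us = flip-col (only-x _ (private-u≢b us))

        bt-plain : ∀ {t} → E v t → col b t ≡ 0
        bt-plain vt = only-y _ (≢-sym (a≢private-v vt))

        b–t : ∀ {t} → E v t → t ≢ b → E b t
        b–t vt t≢b = private-clique ¬vu vb (¬u-private-v vb) vt (¬u-private-v vt) (≢-sym t≢b)

        u⇝v : ProperPath u v
        u⇝v = path₄ ua ab (edge-sym vb) u≢b u≢v a≢v
                (plain≢red ua-plain red) (red≢plain red (only-y v (≢-sym a≢v)))
          where
          a≢v : a ≢ v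
          a≢v = separated (E u) ua ¬uv

        -- u–a–b, continued by b–t unless t = b
        u⇝private-v : ∀ {t} → E v t → ProperPath u t
        u⇝private-v {t} vt with t ≟ b
        ... | yes refl = path₃ ua ab u≢b (plain≢red ua-plain red)
        ... | no t≢b   = path₄ ua ab (b–t vt t≢b) u≢b (≢-sym (separated (E v) vt ¬vu)) (a≢private-v vt)
                           (plain≢red ua-plain red) (red≢plain red (bt-plain vt))

        -- s–a–b–t, omitting s–a if s = a and b–t if t = b
        private-u⇝private-v : ∀ {s t} → E u s → E v t → ¬ E s t → ProperPath s t
        private-u⇝private-v {s} {t} us vt ¬st with s ≟ a | t ≟ b
        ... | yes refl | yes refl = ⊥-elim (¬st ab)
        ... | yes refl | no t≢b   =
          path₃ ab (b–t vt t≢b) (a≢private-v vt) (red≢plain red (bt-plain vt))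
        ... | no s≢a   | yes refl =
          path₃ (s–a us s≢a) ab (private-u≢b us) (plain≢red (sa-plain us) red)
        ... | no s≢a   | no t≢b   =
          path₄ (s–a us s≢a) ab (b–t vt t≢b)
            (private-u≢b us) (separated (E u) us (¬u-private-v vt)) (a≢private-v vt)
            (plain≢red (sa-plain us) red) (red≢plain red (bt-plain vt))

      -- Scenario 2 assembled: U covers paths from the u-side to the v-side,
      -- the mirrored instance V those from the v-side to the u-side.
      noCommonNeighbour-connected : ∀ {u v a b} → u ≢ v → ¬ E u v → (∀ {w} → E u w → ¬ E v w) →
                                    E u a → E v b → E a b → Solo a b → ProperlyConnected G κ
      noCommonNeighbour-connected {u} {v} u≢v ¬uv no-common ua vb ab σ s t s≢t with edge? s t
      ... | yes st = path₂ st
      ... | no ¬st = between s≢t ¬st (place u≢v ¬uv s) (place u≢v ¬uv t)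
        where
        module U = NoCommonNeighbour u≢v ¬uv no-common ua vb ab σ
        module V = NoCommonNeighbour (≢-sym u≢v) (¬uv ∘ edge-sym) (λ vw uw → no-common uw vw)
                                     vb ua (edge-sym ab) (solo-sym σ)
        between : ∀ {s t} → s ≢ t → ¬ E s t → Place u v s → Place u v t → ProperPath s t
        between _   _   (both us vs)    _               = ⊥-elim (no-common us vs)
        between _   _   _               (both ut vt)    = ⊥-elim (no-common ut vt)
        between s≢t _   (at-u refl)     (at-u refl)     = ⊥-elim (s≢t refl)
        between _   _   (at-u refl)     (at-v refl)     = U.u⇝v
        between _   ¬st (at-u refl)     (only-u ut _)   = ⊥-elim (¬st ut)
        between _   _   (at-u refl)     (only-v vt _)   = U.u⇝private-v vt
        between _   _   (at-v refl)     (at-u refl)     = V.u⇝v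
        between s≢t _   (at-v refl)     (at-v refl)     = ⊥-elim (s≢t refl)
        between _   _   (at-v refl)     (only-u ut _)   = V.u⇝private-v ut
        between _   ¬st (at-v refl)     (only-v vt _)   = ⊥-elim (¬st vt)
        between _   ¬st (only-u us _)   (at-u refl)     = ⊥-elim (¬st (edge-sym us))
        between _   _   (only-u us _)   (at-v refl)     = proper-path-sym (V.u⇝private-v us)
        between s≢t ¬st (only-u us ¬vs) (only-u ut ¬vt) = ⊥-elim (¬st (private-clique ¬uv us ¬vs ut ¬vt s≢t))
        between _   ¬st (only-u us _)   (only-v vt _)   = U.private-u⇝private-v us vt ¬st
        between _   _   (only-v vs _)   (at-u refl)     = proper-path-sym (U.u⇝private-v vs)
        between _   ¬st (only-v vs _)   (at-v refl)     = ⊥-elim (¬st (edge-sym vs))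
        between _   ¬st (only-v vs _)   (only-u ut _)   = V.private-u⇝private-v vs ut ¬st
        between s≢t ¬st (only-v vs ¬us) (only-v vt ¬ut) =
          ⊥-elim (¬st (private-clique (¬uv ∘ edge-sym) vs ¬us vt ¬ut s≢t))

    commonNeighbour-pcOpt : ∀ {u v c} → u ≢ v → ¬ E u v → E u c → E v c → pcOptAtMost G 3
    commonNeighbour-pcOpt {u} {v} {c} u≢v ¬uv uc vc with any? (λ b → edge? v b ×-dec ¬? (edge? u b))
    ... | yes (b , vb , ¬ub) =
      matching-pcOpt R (s≤s (s≤s z≤n))
        (CommonNeighbour.connected (matchingColouring R) u≢v ¬uv uc vc
          (matching-solo matching (here refl))
          (λ _ _ → b , vb , ¬ub , matching-solo matching (there (here refl))))
      where
      R : List (Fin n × Fin n)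
      R = (u , c) ∷ (v , b) ∷ []
      matching : IsMatching R
      matching = (edge-≢ uc ∷ edge-≢ vb ∷ []) ,
                 (disjoint u≢v (≢-sym (separated (E v) vb (¬uv ∘ edge-sym)))
                           (edge-≢ (edge-sym vc)) (separated (E u) uc ¬ub) ∷ []) ∷ [] ∷ []
    ... | no no-private =
      matching-pcOpt R (s≤s z≤n)
        (CommonNeighbour.connected (matchingColouring R) u≢v ¬uv uc vc
          (matching-solo ((edge-≢ uc ∷ []) , [] ∷ []) (here refl))
          (λ vt ¬ut → ⊥-elim (no-private (_ , vt , ¬ut))))
      where
      R : List (Fin n × Fin n)
      R = (u , c) ∷ []

    -- Without a common neighbour: a u–v path leaves N[u] through an edge ab
    -- with a ∈ N(u), b ∈ N(v); recolour ab.
    noCommonNeighbour-pcOpt : ∀ {u v} → Connected G → u ≢ v → ¬ E u v →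
                              (∀ {w} → E u w → ¬ E v w) → pcOptAtMost G 3
    noCommonNeighbour-pcOpt {u} {v} conn u≢v ¬uv no-common with conn u v u≢v
    ... | _ , walk , _ , mid , refl
        with leaving-edge N[u] N[u]? u mid (inj₁ refl) v∉N[u] walk
      where
      N[u] : Fin n → Set
      N[u] w = w ≡ u ⊎ E u w
      N[u]? : ∀ w → Dec (N[u] w)
      N[u]? w = (w ≟ u) ⊎-dec edge? u w
      v∉N[u] : ¬ N[u] v
      v∉N[u] (inj₁ v≡u) = u≢v (sym v≡u)
      v∉N[u] (inj₂ uv)  = ¬uv uv
    ... | a , b , ab , inj₁ refl , b∉N[u] = ⊥-elim (b∉N[u] (inj₂ ab))
    ... | a , b , ab , inj₂ ua , b∉N[u] =
      matching-pcOpt ((a , b) ∷ []) (s≤s z≤n)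
        (noCommonNeighbour-connected (matchingColouring ((a , b) ∷ [])) u≢v ¬uv no-common ua vb ab
          (matching-solo ((edge-≢ ab ∷ []) , [] ∷ []) (here refl)))
      where
      b≢v : b ≢ v
      b≢v refl = no-common ua (edge-sym ab)
      vb : E v b
      vb with dominated ¬uv u≢v (b∉N[u] ∘ inj₁) b≢v
      ... | inj₁ ub = ⊥-elim (b∉N[u] (inj₂ ub))
      ... | inj₂ vb = vb

-- Complete graphs need no recolouring; otherwise a non-adjacent pair u, v
-- either has a common neighbour or not.
theorem6 : (n : ℕ) → 1 ≤ n → (G : Graph n) →
    Connected G → αAtMost G 2 → pcOptAtMost G 3
theorem6 n _ G conn α2 with nonAdjacentPair? G
... | no complete = complete-pcOpt G complete
... | yes (u , v , u≢v , ¬uv) with any? (λ c → edge? G u c ×-dec edge? G v c)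
...   | yes (c , uc , vc) = commonNeighbour-pcOpt G α2 u≢v ¬uv uc vc
...   | no none           = noCommonNeighbour-pcOpt G α2 conn u≢v ¬uv λ uw vw → none (_ , uw , vw)
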